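{- Let $k\ge2$, $q\ge1$ and let $\mathbf{v}\in W_{k,q}$ with $0<v_1<v_2<\cdots<v_{k-1}<q-1$. Let $F=F(\mathbf{v},\mathrm{Id})$ with vertices $\mathbf{v}^{(1)},\ldots,\mathbf{v}^{(k)}$, where $\mathbf{v}^{(j)}=\mathbf{v}+e_{k+1-j}+e_{k+2-j}+\cdots+e_{k-1}$. For $1\le i<j\le k$, the facet of $\mathrm{star}_{T_{k,q}}(\mathbf{v}^{(j)})$ indexed by $\pi\in\mathbb{S}_k$ is also a facet of $\mathrm{star}_{T_{k,q}}(\mathbf{v}^{(i)})$ if and only if the last $j-i$ entries of $\pi$ belong to the set $\{k-j+1,k-j+2,\ldots,k-i\}$.
   Context: $R_{k,q}=\{\mathbf{x}\in\mathbb{R}^{k-1}:0\le x_1\le\cdots\le x_{k-1}\le q\}$, $W_{k,q}=R_{k,q}\cap\mathbb{Z}^{k-1}$. A permutation $\pi$ of $[k-1]$ is consistent with $\mathbf{u}\in W_{k,q}$ if $i$ precedes $i+1$ in $\pi$ whenever $u_i=u_{i+1}$; then $F(\mathbf{u},\pi)$ is the simplex with vertices $\mathbf{u}^{(1)}=\mathbf{u}$, $\mathbf{u}^{(m+1)}=\mathbf{u}^{(m)}+e_{\pi_{k-m}}$ ($m=1,\ldots,k-1$; $e_i$ standard basis of $\mathbb{R}^{k-1}$). $T_{k,q}$ is the simplicial complex on $W_{k,q}$ whose facets are all such $F(\mathbf{u},\pi)$; $\mathrm{star}_K(\mathbf{w})$ is the union of all faces containing $\mathbf{w}$. Indexing of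 star facets: for a vertex $\mathbf{w}$ in the interior of $R_{k,q}$ and $\pi=\pi_1\cdots\pi_{i-1}\,k\,\pi_{i+1}\cdots\pi_k\in\mathbb{S}_k$, the facet of $\mathrm{star}_{T_{k,q}}(\mathbf{w})$ indexed by $\pi$ is $F(\mathbf{w}_\pi,\pi')$ with $\pi'=\pi_{i-1}\cdots\pi_1\,\pi_k\cdots\pi_{i+1}\in\mathbb{S}_{k-1}$ and $\mathbf{w}_\pi=\mathbf{w}-e_{\pi_k}-\cdots-e_{\pi_{i+1}}$; this is a bijection between $\mathbb{S}_k$ and the facets of $\mathrm{star}_{T_{k,q}}(\mathbf{w})$. -}

module Defs where

open import Data.Nat as ℕ using (ℕ; zero; suc; _∸_; _≤ᵇ_)
open import Data.Bool using (if_then_else_)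
open import Data.Fin as Fin using (Fin; toℕ; inject₁; fromℕ)
open import Data.Fin.Properties using (_≟_)
open import Data.Fin.Permutation using (Permutation′; _⟨$⟩ʳ_; _⟨$⟩ˡ_)
open import Data.Integer as ℤ using (ℤ; +_; _+_; _-_)
open import Data.Vec as Vec using (Vec; lookup; tabulate; zipWith)
open import Data.List as List using (List; []; _∷_; map; reverse; take; drop; _++_; foldr; allFin)
open import Data.List.Membership.Propositional using (_∈_)
open import Data.Product using (Σ; _×_; ∃)
open import Relation.Nullary using (does)
open import Relation.Binary.PropositionalEquality using (_≡_)

-- Points of ℤ^n (here n = k-1); coordinates indexed by Fin n (coordinate c ↔ index toℕ c + 1).
Pt : ℕ → Set
Pt n = Vec ℤ n

_⊕_ : ∀ {n} → Pt n → Pt n → Pt n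
_⊕_ = zipWith _+_

_⊖_ : ∀ {n} → Pt n → Pt n → Pt n
_⊖_ = zipWith _-_

unit : ∀ {n} → Fin n → Pt n
unit a = tabulate λ c → if does (c ≟ a) then + 1 else + 0

-- e_v for a value v ∈ {1..k} of a permutation of [k] (k = suc n), where value
-- inject₁ c stands for coordinate c; only ever applied to values ≠ k (= fromℕ n).
unitK : ∀ {n} → Fin (suc n) → Pt n
unitK v = tabulate λ c → if does (inject₁ c ≟ v) then + 1 else + 0

walk : ∀ {n} {A : Set} → (A → Pt n) → Pt n → List A → List (Pt n)
walk f u []       = u ∷ []
walk f u (a ∷ as) = u ∷ walk f (u ⊕ f a) as

oneLine : ∀ {n} → Permutation′ n → List (Fin n)
oneLine {n} π = map (π ⟨$⟩ʳ_) (allFin n)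

-- vertex list u⁽¹⁾,…,u⁽ᵏ⁾ of F(u,π): u⁽ᵐ⁺¹⁾ = u⁽ᵐ⁾ + e_{π_{k-m}}
simplex : ∀ {n} → Pt n → Permutation′ n → List (Pt n)
simplex u π = walk unit u (reverse (oneLine π))

SameSet : ∀ {n} → List (Pt n) → List (Pt n) → Set
SameSet S T = ∀ x → (x ∈ S → x ∈ T) × (x ∈ T → x ∈ S)

InW : ∀ {n} → ℕ → Pt n → Set
InW q u = (∀ a → (+ 0 ℤ.≤ lookup u a) × (lookup u a ℤ.≤ + q))
        × (∀ a b → toℕ b ≡ suc (toℕ a) → lookup u a ℤ.≤ lookup u b)

Consistent : ∀ {n} → Pt n → Permutation′ n → Set
Consistent u π = ∀ a b → toℕ b ≡ suc (toℕ a) → lookup u a ≡ lookup u b →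
                 toℕ (π ⟨$⟩ˡ a) ℕ.< toℕ (π ⟨$⟩ˡ b)

IsFacetT : ∀ {n} → ℕ → List (Pt n) → Set
IsFacetT {n} q S = Σ (Pt n) λ u → Σ (Permutation′ n) λ σ →
                   InW q u × Consistent u σ × SameSet S (simplex u σ)

IsStarFacet : ∀ {n} → ℕ → Pt n → List (Pt n) → Set
IsStarFacet q w S = IsFacetT q S × (w ∈ S)

-- Facet of star(w) indexed by π = π₁⋯π_{i-1} k π_{i+1}⋯π_k ∈ S_k:
-- F(w_π, π') with π' = π_{i-1}⋯π₁ π_k⋯π_{i+1}, w_π = w - e_{π_k} - ⋯ - e_{π_{i+1}}
module _ {n : ℕ} (π : Permutation′ (suc n)) where
  posK : Fin (suc n)
  posK = π ⟨$⟩ˡ fromℕ n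

  before : List (Fin (suc n))
  before = take (toℕ posK) (oneLine π)

  after : List (Fin (suc n))
  after = drop (suc (toℕ posK)) (oneLine π)

  π′ : List (Fin (suc n))
  π′ = reverse before ++ reverse after

indexedFacet : ∀ {n} → Pt n → Permutation′ (suc n) → List (Pt n)
indexedFacet w π = walk unitK wπ (reverse (π′ π))
  where wπ = foldr (λ a x → x ⊖ unitK a) w (after π)

-- v⁽ʲ⁾ = v + e_{k+1-j} + ⋯ + e_{k-1}  (k = suc n, 1 ≤ j ≤ k)
vtx : ∀ {n} → Pt n → ℕ → Pt n
vtx {n} v j = tabulate λ c → lookup v c + (if (suc n ∸ j) ≤ᵇ toℕ c then + 1 else + 0)

-- the last j-i entries of π ∈ S_k belong to {k-j+1, …, k-i}
-- (position t is 1-based toℕ t + 1, value π(t) is 1-based toℕ (π t) + 1)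
LastEntriesIn : ∀ {k} → Permutation′ k → ℕ → ℕ → Set
LastEntriesIn {k} π i j = ∀ (t : Fin k) → k ∸ (j ∸ i) ℕ.≤ toℕ t →
  (k ∸ j ℕ.≤ toℕ (π ⟨$⟩ʳ t)) × (toℕ (π ⟨$⟩ʳ t) ℕ.< k ∸ i)

{-# OPTIONS --safe #-}
-- The facet of star(w) indexed by π is F(w_π, π′): its vertices are w_π = w − Σ_{a ∈ after π} e_a
-- followed by the partial sums of the unit vectors along after π ++ before π. When w = v⁽ʲ⁾ is
-- interior, w_π ∈ W_{k,q}, and π′ is consistent with w_π: two consecutive coordinates of w_π can
-- only agree when the smaller value stands before k in π and the larger one after it.
-- Membership of v⁽ⁱ⁾ = v⁽ʲ⁾ − e_{k−j+1} − ⋯ − e_{k−i} is decided by coordinate sums. They grow by one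
-- along the facet, so the only candidate vertex is v⁽ʲ⁾ minus the unit vectors of the last j − i
-- entries of π. These are distinct, so the candidate is v⁽ⁱ⁾ exactly when its 0/1 difference from
-- v⁽ʲ⁾ is dominated by e_{k−j+1} + ⋯ + e_{k−i}, i.e. when those entries lie in {k−j+1, …, k−i}.
module Submission where

open import Defs
open import Data.Bool using (Bool; true; false; T; if_then_else_)
open import Data.Empty using (⊥-elim)
open import Data.Fin as Fin using (Fin; zero; suc; toℕ; inject₁; fromℕ)
import Data.Fin.Properties as Fin
open import Data.Fin.Properties using (_≟_)
open import Data.Fin.Permutation
  using (Permutation′; _⟨$⟩ʳ_; _⟨$⟩ˡ_; inverseˡ; inverseʳ; permutation; remove; _∘ₚ_; punchIn-permute)
open import Data.Integer as ℤ using (ℤ; +_; _+_; _-_; -_)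
import Data.Integer.Properties as ℤ
open import Data.Integer.Tactic.RingSolver using (solve-∀)
open import Data.List as List using (List; []; _∷_; map; take; drop; _++_; foldr; length)
import Data.List.Properties as List
open import Data.List.Membership.Propositional using (_∈_; _∉_)
open import Data.List.Membership.Propositional.Properties using (∈-tabulate⁺; ∈-tabulate⁻)
open import Data.List.Relation.Unary.All as All using (All; []; _∷_)
import Data.List.Relation.Unary.All.Properties as All
open import Data.List.Relation.Unary.AllPairs using (_∷_)
open import Data.List.Relation.Unary.Any using (here; there)
open import Data.List.Relation.Unary.Unique.Propositional using (Unique)
import Data.List.Relation.Unary.Unique.Propositional.Properties as Unique
open import Data.Nat as ℕ using (ℕ; zero; suc; _∸_; _≤ᵇ_; _≤_; _<_; z≤n; s≤s)
import Data.Nat.Properties as ℕ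
open import Data.Nat.Tactic.RingSolver using () renaming (solve-∀ to ℕ-solve-∀)
open import Data.Product using (∃; _×_; _,_; proj₁; proj₂; uncurry)
open import Data.Unit using (tt)
open import Data.Vec as Vec using (Vec; []; _∷_; lookup; tabulate; replicate)
import Data.Vec.Properties as Vec
open import Function using (_∘_; id)
open import Function.Bundles using (_⇔_; mk⇔)
open import Relation.Binary.PropositionalEquality
open import Relation.Nullary using (¬_; yes; no; does)
open import Relation.Nullary.Decidable using (dec-true; dec-false)
open import Algebra.Properties.AbelianGroup ℤ.+-0-abelianGroup using (∙-cancelˡ; ∙-cancelʳ)
open import Algebra.Properties.CommutativeSemigroup ℤ.+-commutativeSemigroup using (interchange)

lookup-⊕ : ∀ {n} (x y : Pt n) c → lookup (x ⊕ y) c ≡ lookup x c + lookup y c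
lookup-⊕ x y c = Vec.lookup-zipWith _+_ c x y

lookup-⊖ : ∀ {n} (x y : Pt n) c → lookup (x ⊖ y) c ≡ lookup x c - lookup y c
lookup-⊖ x y c = Vec.lookup-zipWith _-_ c x y

⊖-⊖ : ∀ {n} (w s a : Pt n) → (w ⊖ s) ⊖ a ≡ w ⊖ (a ⊕ s)
⊖-⊖ []       []       []       = refl
⊖-⊖ (w ∷ ws) (s ∷ ss) (a ∷ as) = cong₂ _∷_ (identity w s a) (⊖-⊖ ws ss as)
  where
  identity : ∀ w s a → (w - s) - a ≡ w - (a + s)
  identity = solve-∀

⊖⊕-⊕ : ∀ {n} (w a b : Pt n) → (w ⊖ (a ⊕ b)) ⊕ a ≡ w ⊖ b
⊖⊕-⊕ []       []       []       = refl
⊖⊕-⊕ (w ∷ ws) (a ∷ as) (b ∷ bs) = cong₂ _∷_ (identity w a b) (⊖⊕-⊕ ws as bs)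
  where
  identity : ∀ w a b → (w - (a + b)) + a ≡ w - b
  identity = solve-∀

take-++ˡ : ∀ {A : Set} (xs ys : List A) {t} → t ≤ length xs → take t (xs ++ ys) ≡ take t xs
take-++ˡ xs       ys {zero}  _        = refl
take-++ˡ (x ∷ xs) ys {suc t} (s≤s t≤) = cong (x ∷_) (take-++ˡ xs ys t≤)

module _ {n : ℕ} {A : Set} (f : A → Pt n) where

  vsum : List A → Pt n
  vsum = foldr (λ a s → f a ⊕ s) (replicate n (+ 0))

  vsum-++ : ∀ xs ys → vsum (xs ++ ys) ≡ vsum xs ⊕ vsum ys
  vsum-++ []       ys = sym (Vec.zipWith-identityˡ ℤ.+-identityˡ (vsum ys))
  vsum-++ (x ∷ xs) ys = trans (cong (f x ⊕_) (vsum-++ xs ys))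
                              (sym (Vec.zipWith-assoc ℤ.+-assoc (f x) (vsum xs) (vsum ys)))

  foldr-⊖≡⊖vsum : ∀ w xs → foldr (λ a x → x ⊖ f a) w xs ≡ w ⊖ vsum xs
  foldr-⊖≡⊖vsum w []       = sym (Vec.zipWith-identityʳ ℤ.+-identityʳ w)
  foldr-⊖≡⊖vsum w (x ∷ xs) = trans (cong (_⊖ f x) (foldr-⊖≡⊖vsum w xs)) (⊖-⊖ w (vsum xs) (f x))

  ⊖vsum-⊕vsum-take : ∀ w xs ys {t} → t ≤ length xs →
                     (w ⊖ vsum xs) ⊕ vsum (take t (xs ++ ys)) ≡ w ⊖ vsum (drop t xs)
  ⊖vsum-⊕vsum-take w xs ys {t} t≤ = begin
    (w ⊖ vsum xs) ⊕ vsum (take t (xs ++ ys))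
      ≡⟨ cong₂ (λ s p → (w ⊖ vsum s) ⊕ vsum p) (sym (List.take++drop≡id t xs)) (take-++ˡ xs ys t≤) ⟩
    (w ⊖ vsum (take t xs ++ drop t xs)) ⊕ vsum (take t xs)
      ≡⟨ cong (λ s → (w ⊖ s) ⊕ vsum (take t xs)) (vsum-++ (take t xs) (drop t xs)) ⟩
    (w ⊖ (vsum (take t xs) ⊕ vsum (drop t xs))) ⊕ vsum (take t xs)
      ≡⟨ ⊖⊕-⊕ w (vsum (take t xs)) (vsum (drop t xs)) ⟩
    w ⊖ vsum (drop t xs) ∎
    where open ≡-Reasoning

  ∈-walk⁻ : ∀ {u x} xs → x ∈ walk f u xs → ∃ λ t → t ≤ length xs × x ≡ u ⊕ vsum (take t xs)
  ∈-walk⁻ {u} []       (here refl) = zero , z≤n , sym (Vec.zipWith-identityʳ ℤ.+-identityʳ u)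
  ∈-walk⁻ {u} (a ∷ xs) (here refl) = zero , z≤n , sym (Vec.zipWith-identityʳ ℤ.+-identityʳ u)
  ∈-walk⁻ {u} (a ∷ xs) (there x∈) with ∈-walk⁻ xs x∈
  ... | t , t≤ , refl = suc t , s≤s t≤ , Vec.zipWith-assoc ℤ.+-assoc u (f a) (vsum (take t xs))

  ∈-walk⁺ : ∀ u xs {t} → t ≤ length xs → u ⊕ vsum (take t xs) ∈ walk f u xs
  ∈-walk⁺ u []       z≤n              = here (Vec.zipWith-identityʳ ℤ.+-identityʳ u)
  ∈-walk⁺ u (a ∷ xs) z≤n              = here (Vec.zipWith-identityʳ ℤ.+-identityʳ u)
  ∈-walk⁺ u (a ∷ xs) {suc t} (s≤s t≤) = there (subst (_∈ walk f (u ⊕ f a) xs)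
    (Vec.zipWith-assoc ℤ.+-assoc u (f a) (vsum (take t xs))) (∈-walk⁺ (u ⊕ f a) xs t≤))

walk-map : ∀ {n} {A B : Set} (f : B → Pt n) (g : A → B) u xs → walk f u (map g xs) ≡ walk (f ∘ g) u xs
walk-map f g u []       = refl
walk-map f g u (x ∷ xs) = cong (u ∷_) (walk-map f g (u ⊕ f (g x)) xs)

walk-cong : ∀ {n} {A : Set} {f g : A → Pt n} → (∀ a → f a ≡ g a) → ∀ u xs → walk f u xs ≡ walk g u xs
walk-cong         f≗g u []       = refl
walk-cong {f = f} f≗g u (x ∷ xs) =
  cong (u ∷_) (trans (walk-cong f≗g (u ⊕ f x) xs) (cong (λ y → walk _ (u ⊕ y) xs) (f≗g x)))

-- Coordinate sums

coordSum : ∀ {n} → Pt n → ℤ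
coordSum []       = + 0
coordSum (x ∷ xs) = x + coordSum xs

coordSum-⊕ : ∀ {n} (x y : Pt n) → coordSum (x ⊕ y) ≡ coordSum x + coordSum y
coordSum-⊕ []      []      = refl
coordSum-⊕ (a ∷ x) (b ∷ y) =
  trans (cong (_+_ (a + b)) (coordSum-⊕ x y)) (interchange a b (coordSum x) (coordSum y))

coordSum-⊖ : ∀ {n} (x y : Pt n) → coordSum (x ⊖ y) ≡ coordSum x - coordSum y
coordSum-⊖ []      []      = refl
coordSum-⊖ (a ∷ x) (b ∷ y) =
  trans (cong (_+_ (a - b)) (coordSum-⊖ x y)) (interchange⁻ a b (coordSum x) (coordSum y))
  where
  interchange⁻ : ∀ a b c d → (a - b) + (c - d) ≡ (a + c) - (b + d)
  interchange⁻ = solve-∀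

coordSum-replicate-0 : ∀ n → coordSum (replicate n (+ 0)) ≡ + 0
coordSum-replicate-0 zero    = refl
coordSum-replicate-0 (suc n) = trans (ℤ.+-identityˡ _) (coordSum-replicate-0 n)

coordSum-tabulate-0 : ∀ n → coordSum (tabulate {n = n} λ _ → + 0) ≡ + 0
coordSum-tabulate-0 zero    = refl
coordSum-tabulate-0 (suc n) = trans (ℤ.+-identityˡ _) (coordSum-tabulate-0 n)

coordSum-tabulate-+ : ∀ {n} (v : Pt n) (g : Fin n → ℤ) →
                      coordSum (tabulate λ c → lookup v c + g c) ≡ coordSum v + coordSum (tabulate g)
coordSum-tabulate-+ []      g = refl
coordSum-tabulate-+ (a ∷ v) g = trans (cong (_+_ (a + g zero)) (coordSum-tabulate-+ v (g ∘ suc)))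
                                      (interchange a (g zero) (coordSum v) (coordSum (tabulate (g ∘ suc))))

coordSum-mono-≤ : ∀ {n} {x y : Pt n} → (∀ c → lookup x c ℤ.≤ lookup y c) → coordSum x ℤ.≤ coordSum y
coordSum-mono-≤ {x = []}    {[]}    _   = ℤ.≤-refl
coordSum-mono-≤ {x = a ∷ x} {b ∷ y} x≤y = ℤ.+-mono-≤ (x≤y zero) (coordSum-mono-≤ {x = x} {y} (x≤y ∘ suc))

≤∧coordSum≡⇒≡ : ∀ {n} {x y : Pt n} → (∀ c → lookup x c ℤ.≤ lookup y c) → coordSum x ≡ coordSum y → x ≡ y
≤∧coordSum≡⇒≡ {x = []}    {[]}    _   _  = refl
≤∧coordSum≡⇒≡ {x = a ∷ x} {b ∷ y} x≤y eq = cong₂ _∷_ a≡b (≤∧coordSum≡⇒≡ {x = x} {y} (x≤y ∘ suc) tails≡)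
  where
  a≡b : a ≡ b
  a≡b = ℤ.≤-antisym (x≤y zero) (ℤ.≮⇒≥ λ a<b →
          ℤ.<-irrefl eq (ℤ.+-mono-<-≤ a<b (coordSum-mono-≤ {x = x} {y} (x≤y ∘ suc))))
  tails≡ : coordSum x ≡ coordSum y
  tails≡ = ∙-cancelˡ b _ _ (subst (λ a → a + coordSum x ≡ b + coordSum y) a≡b eq)

x+a≡x+b-c+e⇒a+c≡b+e : ∀ x a b c e → x + + a ≡ ((x + + b) - + c) + + e → a ℕ.+ c ≡ b ℕ.+ e
x+a≡x+b-c+e⇒a+c≡b+e x a b c e eq = ℤ.+-injective (∙-cancelˡ x (+ (a ℕ.+ c)) (+ (b ℕ.+ e)) (begin
  x + + (a ℕ.+ c)                 ≡⟨ cong (_+_ x) (ℤ.pos-+ a c) ⟩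
  x + (+ a + + c)                 ≡⟨ ℤ.+-assoc x (+ a) (+ c) ⟨
  (x + + a) + + c                 ≡⟨ cong (_+ + c) eq ⟩
  (((x + + b) - + c) + + e) + + c ≡⟨ rearrange x (+ b) (+ c) (+ e) ⟩
  x + (+ b + + e)                 ≡⟨ cong (_+_ x) (ℤ.pos-+ b e) ⟨
  x + + (b ℕ.+ e)                 ∎))
  where
  open ≡-Reasoning
  rearrange : ∀ x b c e → (((x + b) - c) + e) + c ≡ x + (b + e)
  rearrange = solve-∀

x+a≡x+[c+a]-c : ∀ x a c → x + + a ≡ (x + + (c ℕ.+ a)) - + c
x+a≡x+[c+a]-c x a c = trans (rearrange x (+ a) (+ c)) (cong (λ y → (x + y) - + c) (ℤ.pos-+ c a))
  where
  rearrange : ∀ x a c → x + a ≡ (x + (c + a)) - c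
  rearrange = solve-∀

-- Defs writes the 0/1 entries of unitK, unit and vtx inline; they are definitionally ind b.
ind : Bool → ℤ
ind b = if b then + 1 else + 0

ind-T : ∀ {b} → T b → ind b ≡ + 1
ind-T {true} _ = refl

ind-¬T : ∀ {b} → ¬ T b → ind b ≡ + 0
ind-¬T {true}  ¬b = ⊥-elim (¬b tt)
ind-¬T {false} _  = refl

ind-mono : ∀ {p q} → (T p → T q) → ind p ℤ.≤ ind q
ind-mono {false} {false} _   = ℤ.≤-refl
ind-mono {false} {true}  _   = ℤ.+≤+ z≤n
ind-mono {true}  {false} p⇒q = ⊥-elim (p⇒q tt)
ind-mono {true}  {true}  _   = ℤ.≤-refl

x-0≡x : ∀ x → x - + 0 ≡ x
x-0≡x = ℤ.+-identityʳ

x-1≡pred : ∀ x → x - + 1 ≡ ℤ.pred x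
x-1≡pred x = ℤ.+-comm x ℤ.-1ℤ

x-ind≤x : ∀ x b → x - ind b ℤ.≤ x
x-ind≤x x false = ℤ.≤-reflexive (x-0≡x x)
x-ind≤x x true  = ℤ.i≤j⇒i-k≤j (+ 1) ℤ.≤-refl

pred≤x-ind : ∀ x b → ℤ.pred x ℤ.≤ x - ind b
pred≤x-ind x false = ℤ.i≤j⇒pred[i]≤j (ℤ.≤-reflexive (sym (x-0≡x x)))
pred≤x-ind x true  = ℤ.≤-reflexive (sym (x-1≡pred x))

0<x⇒0≤x-ind : ∀ {x} b → + 0 ℤ.< x → + 0 ℤ.≤ x - ind b
0<x⇒0≤x-ind {x} b 0<x = ℤ.≤-trans (ℤ.i<j⇒i≤pred[j] 0<x) (pred≤x-ind x b)

<⇒x-ind≤y-ind : ∀ {x y} b b′ → x ℤ.< y → x - ind b ℤ.≤ y - ind b′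
<⇒x-ind≤y-ind {x} {y} b b′ x<y =
  ℤ.≤-trans (x-ind≤x x b) (ℤ.≤-trans (ℤ.i<j⇒i≤pred[j] x<y) (pred≤x-ind y b′))

<∧x-ind≡y-ind⇒ : ∀ {x y} b b′ → x ℤ.< y → x - ind b ≡ y - ind b′ → ¬ T b × T b′
<∧x-ind≡y-ind⇒         false true  _   _  = (λ ()) , tt
<∧x-ind≡y-ind⇒ {x} {y} b     false x<y eq =
  ⊥-elim (ℤ.<-irrefl eq (ℤ.≤-<-trans (x-ind≤x x b) (subst (x ℤ.<_) (sym (x-0≡x y)) x<y)))
<∧x-ind≡y-ind⇒ {x} {y} true  true  x<y eq = ⊥-elim (ℤ.<-irrefl (∙-cancelʳ (- + 1) x y eq) x<y)

x+ind≡x+ind-1⇒ : ∀ x p q → x + ind p ≡ (x + ind q) - + 1 → ¬ T p × T q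
x+ind≡x+ind-1⇒ x p q eq = bits p q (∙-cancelˡ x (ind p) (ind q - + 1) (trans eq (ℤ.+-assoc x (ind q) (- + 1))))
  where
  bits : ∀ p q → ind p ≡ ind q - + 1 → ¬ T p × T q
  bits false true  _  = (λ ()) , tt
  bits false false ()
  bits true  false ()
  bits true  true  ()

x+ind≤x+ind-ind : ∀ x p q r → (T r → ¬ T p × T q) → (T p → T q) → x + ind p ℤ.≤ (x + ind q) - ind r
x+ind≤x+ind-ind x p q r r⇒ p⇒q =
  subst (x + ind p ℤ.≤_) (sym (ℤ.+-assoc x (ind q) (- ind r))) (ℤ.+-monoʳ-≤ x (bits p q r r⇒ p⇒q))
  where
  bits : ∀ p q r → (T r → ¬ T p × T q) → (T p → T q) → ind p ℤ.≤ ind q - ind r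
  bits p     q     false _  p⇒q = subst (ind p ℤ.≤_) (sym (x-0≡x (ind q))) (ind-mono p⇒q)
  bits false true  true  _  _   = ℤ.≤-refl
  bits false false true  r⇒ _   = ⊥-elim (proj₂ (r⇒ tt))
  bits true  q     true  r⇒ _   = ⊥-elim (proj₁ (r⇒ tt) tt)

≤ᵇ-suc : ∀ a x → (suc a ≤ᵇ suc x) ≡ (a ≤ᵇ x)
≤ᵇ-suc zero    x = refl
≤ᵇ-suc (suc a) x = refl

coordSum-tabulate-≤ᵇ : ∀ n a → coordSum (tabulate {n = n} λ c → ind (a ≤ᵇ toℕ c)) ≡ + (n ∸ a)
coordSum-tabulate-≤ᵇ zero    zero    = refl
coordSum-tabulate-≤ᵇ zero    (suc a) = refl
coordSum-tabulate-≤ᵇ (suc n) zero    = cong (_+_ (+ 1)) (coordSum-tabulate-≤ᵇ n zero)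
coordSum-tabulate-≤ᵇ (suc n) (suc a) = trans (ℤ.+-identityˡ _) (trans
  (cong coordSum (Vec.tabulate-cong {n = n} λ c → cong ind (≤ᵇ-suc a (toℕ c)))) (coordSum-tabulate-≤ᵇ n a))

unitK-inject₁ : ∀ {n} (a : Fin n) → unitK (inject₁ a) ≡ unit a
unitK-inject₁ zero    = refl
unitK-inject₁ (suc a) = cong (+ 0 ∷_) (unitK-inject₁ a)

coordSum-unitK : ∀ {n} (a : Fin (suc n)) → fromℕ n ≢ a → coordSum (unitK a) ≡ + 1
coordSum-unitK {zero}  zero    n≢a = ⊥-elim (n≢a refl)
coordSum-unitK {suc n} zero    _   = cong (_+_ (+ 1)) (coordSum-tabulate-0 n)
coordSum-unitK {suc n} (suc a) n≢a = trans (ℤ.+-identityˡ _) (coordSum-unitK a (n≢a ∘ cong suc))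

module _ {n : ℕ} where

  lookup-unitK-≡ : ∀ {a : Fin (suc n)} {c} → inject₁ c ≡ a → lookup (unitK a) c ≡ + 1
  lookup-unitK-≡ {a} {c} c≡a = trans (Vec.lookup∘tabulate _ c) (cong ind (dec-true (inject₁ c ≟ a) c≡a))

  lookup-unitK-≢ : ∀ {a : Fin (suc n)} {c} → inject₁ c ≢ a → lookup (unitK a) c ≡ + 0
  lookup-unitK-≢ {a} {c} c≢a = trans (Vec.lookup∘tabulate _ c) (cong ind (dec-false (inject₁ c ≟ a) c≢a))

  coordSum-vsum-unitK : ∀ {xs : List (Fin (suc n))} → All (fromℕ n ≢_) xs →
                        coordSum (vsum unitK xs) ≡ + length xs
  coordSum-vsum-unitK {[]}     []          = coordSum-replicate-0 n
  coordSum-vsum-unitK {a ∷ xs} (n≢a ∷ n∉) = begin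
    coordSum (unitK a ⊕ vsum unitK xs)            ≡⟨ coordSum-⊕ (unitK a) (vsum unitK xs) ⟩
    coordSum (unitK a) + coordSum (vsum unitK xs) ≡⟨ cong₂ _+_ (coordSum-unitK a n≢a) (coordSum-vsum-unitK n∉) ⟩
    + 1 + + length xs                             ∎
    where open ≡-Reasoning

  lookup-vsum-unitK-∉ : ∀ (xs : List (Fin (suc n))) {c} → inject₁ c ∉ xs → lookup (vsum unitK xs) c ≡ + 0
  lookup-vsum-unitK-∉ []       {c} _  = Vec.lookup-replicate c (+ 0)
  lookup-vsum-unitK-∉ (a ∷ xs) {c} c∉ = begin
    lookup (unitK a ⊕ vsum unitK xs) c            ≡⟨ lookup-⊕ (unitK a) (vsum unitK xs) c ⟩
    lookup (unitK a) c + lookup (vsum unitK xs) c ≡⟨ cong₂ _+_ (lookup-unitK-≢ (c∉ ∘ here)) (lookup-vsum-unitK-∉ xs (c∉ ∘ there)) ⟩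
    + 0                                           ∎
    where open ≡-Reasoning

  lookup-vsum-unitK-∈ : ∀ {xs : List (Fin (suc n))} {c} → Unique xs → inject₁ c ∈ xs →
                        lookup (vsum unitK xs) c ≡ + 1
  lookup-vsum-unitK-∈ {a ∷ xs} {c} (a∉xs ∷ uniq) c∈ = begin
    lookup (unitK a ⊕ vsum unitK xs) c            ≡⟨ lookup-⊕ (unitK a) (vsum unitK xs) c ⟩
    lookup (unitK a) c + lookup (vsum unitK xs) c ≡⟨ split c∈ ⟩
    + 1                                           ∎
    where
    open ≡-Reasoning
    split : inject₁ c ∈ a ∷ xs → lookup (unitK a) c + lookup (vsum unitK xs) c ≡ + 1
    split (here c≡a)  = cong₂ _+_ (lookup-unitK-≡ c≡a)
                                  (lookup-vsum-unitK-∉ xs λ c∈xs → All.lookup a∉xs c∈xs (sym c≡a))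
    split (there c∈xs) = cong₂ _+_ (lookup-unitK-≢ (All.lookup a∉xs c∈xs ∘ sym)) (lookup-vsum-unitK-∈ uniq c∈xs)

fromℕ≢⇒inject₁ : ∀ {n} (y : Fin (suc n)) → fromℕ n ≢ y → ∃ λ c → inject₁ c ≡ y
fromℕ≢⇒inject₁ {n} y n≢y = Fin.lower₁ y n≢toℕy , Fin.inject₁-lower₁ y n≢toℕy
  where
  n≢toℕy : n ≢ toℕ y
  n≢toℕy n≡y = n≢y (Fin.toℕ-injective (trans (Fin.toℕ-fromℕ n) n≡y))

module _ {A : Set} where

  ∈-drop-tabulate⁺ : ∀ {k} (f : Fin k → A) {d} s → d ≤ toℕ s → f s ∈ drop d (List.tabulate f)
  ∈-drop-tabulate⁺ f {zero}  s       _         = ∈-tabulate⁺ s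
  ∈-drop-tabulate⁺ f {suc d} (suc s) (s≤s d≤s) = ∈-drop-tabulate⁺ (f ∘ suc) s d≤s

  ∈-drop-tabulate⁻ : ∀ {k} (f : Fin k → A) d {y} → y ∈ drop d (List.tabulate f) →
                     ∃ λ s → d ≤ toℕ s × y ≡ f s
  ∈-drop-tabulate⁻ f zero y∈ with ∈-tabulate⁻ y∈
  ... | s , y≡fs = s , z≤n , y≡fs
  ∈-drop-tabulate⁻ {suc k} f (suc d) y∈ with ∈-drop-tabulate⁻ (f ∘ suc) d y∈
  ... | s , d≤s , y≡fs = suc s , s≤s d≤s , y≡fs

  ∈-take-tabulate⁻ : ∀ {k} (f : Fin k → A) d {y} → y ∈ take d (List.tabulate f) →
                     ∃ λ s → toℕ s < d × y ≡ f s
  ∈-take-tabulate⁻ {suc k} f (suc d) (here y≡f0) = zero , s≤s z≤n , y≡f0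
  ∈-take-tabulate⁻ {suc k} f (suc d) (there y∈) with ∈-take-tabulate⁻ (f ∘ suc) d y∈
  ... | s , s<d , y≡fs = suc s , s≤s s<d , y≡fs

  applyUpTo-++ : ∀ (f : ℕ → A) m k → List.applyUpTo f (m ℕ.+ k) ≡ List.applyUpTo f m ++ List.applyUpTo (f ∘ (m ℕ.+_)) k
  applyUpTo-++ f zero    k = refl
  applyUpTo-++ f (suc m) k = cong (f 0 ∷_) (applyUpTo-++ (f ∘ suc) m k)

  take-applyUpTo : ∀ (f : ℕ → A) m k → take m (List.applyUpTo f (m ℕ.+ k)) ≡ List.applyUpTo f m
  take-applyUpTo f zero    k = refl
  take-applyUpTo f (suc m) k = cong (f 0 ∷_) (take-applyUpTo (f ∘ suc) m k)

  drop-applyUpTo : ∀ (f : ℕ → A) m k → drop m (List.applyUpTo f (m ℕ.+ k)) ≡ List.applyUpTo (f ∘ (m ℕ.+_)) k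
  drop-applyUpTo f zero    k = refl
  drop-applyUpTo f (suc m) k = drop-applyUpTo (f ∘ suc) m k

  applyUpTo≡applyDownFrom : ∀ {g f : ℕ → A} m → (∀ {x} → x < m → g x ≡ f (m ∸ suc x)) →
                            List.applyUpTo g m ≡ List.applyDownFrom f m
  applyUpTo≡applyDownFrom zero    _      = refl
  applyUpTo≡applyDownFrom (suc m) g≡f∘ = cong₂ _∷_ (g≡f∘ (s≤s z≤n)) (applyUpTo≡applyDownFrom m (g≡f∘ ∘ s≤s))

  tabulate-toℕ : ∀ (f : ℕ → A) n → List.tabulate {n = n} (f ∘ toℕ) ≡ List.applyUpTo f n
  tabulate-toℕ f zero    = refl
  tabulate-toℕ f (suc n) = cong (f 0 ∷_) (tabulate-toℕ (f ∘ suc) n)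

  map-allFin : ∀ (f : ℕ → A) n → map (f ∘ toℕ) (List.allFin n) ≡ List.applyUpTo f n
  map-allFin f n = trans (List.map-tabulate id (f ∘ toℕ)) (tabulate-toℕ f n)

  -- π′ π is reversedBlocks (toℕ (posK π)) (oneLine π)
  reversedBlocks : ℕ → List A → List A
  reversedBlocks p xs = List.reverse (take p xs) ++ List.reverse (drop (suc p) xs)

map-reversedBlocks : ∀ {A B : Set} (f : A → B) p xs → map f (reversedBlocks p xs) ≡ reversedBlocks p (map f xs)
map-reversedBlocks f p xs = begin
  map f (List.reverse (take p xs) ++ List.reverse (drop (suc p) xs))
    ≡⟨ List.map-++ f (List.reverse (take p xs)) (List.reverse (drop (suc p) xs)) ⟩
  map f (List.reverse (take p xs)) ++ map f (List.reverse (drop (suc p) xs))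
    ≡⟨ cong₂ _++_ (List.reverse-map f (take p xs)) (List.reverse-map f (drop (suc p) xs)) ⟩
  List.reverse (map f (take p xs)) ++ List.reverse (map f (drop (suc p) xs))
    ≡⟨ cong₂ (λ ys zs → List.reverse ys ++ List.reverse zs) (List.take-map p xs) (List.drop-map (suc p) xs) ⟨
  reversedBlocks p (map f xs) ∎
  where open ≡-Reasoning

reversedBlocks-upTo : ∀ p e → reversedBlocks p (List.upTo (suc (p ℕ.+ e))) ≡
                              List.downFrom p ++ List.applyDownFrom (suc p ℕ.+_) e
reversedBlocks-upTo p e = cong₂ _++_
  (trans (cong (λ m → List.reverse (take p (List.upTo m))) (sym (ℕ.+-suc p e)))
         (trans (cong List.reverse (take-applyUpTo id p (suc e))) (List.reverse-upTo p)))
  (trans (cong List.reverse (drop-applyUpTo id (suc p) e)) (List.reverse-applyUpTo (suc p ℕ.+_) e))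

-- One-line notation and indexed facets

module _ {k : ℕ} (π : Permutation′ k) where

  oneLine≡tabulate : oneLine π ≡ List.tabulate (π ⟨$⟩ʳ_)
  oneLine≡tabulate = List.map-tabulate id (π ⟨$⟩ʳ_)

  length-oneLine : length (oneLine π) ≡ k
  length-oneLine = trans (cong length oneLine≡tabulate) (List.length-tabulate (π ⟨$⟩ʳ_))

  unique-oneLine : Unique (oneLine π)
  unique-oneLine = Unique.map⁺ injective (Unique.allFin⁺ k)
    where
    injective : ∀ {s t} → π ⟨$⟩ʳ s ≡ π ⟨$⟩ʳ t → s ≡ t
    injective eq = trans (sym (inverseˡ π)) (trans (cong (π ⟨$⟩ˡ_) eq) (inverseˡ π))

  ∈-drop-oneLine⁺ : ∀ {d} s → d ≤ toℕ s → π ⟨$⟩ʳ s ∈ drop d (oneLine π)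
  ∈-drop-oneLine⁺ {d} s d≤s =
    subst (λ xs → π ⟨$⟩ʳ s ∈ drop d xs) (sym oneLine≡tabulate) (∈-drop-tabulate⁺ (π ⟨$⟩ʳ_) s d≤s)

  ∈-drop-oneLine⁻ : ∀ d {y} → y ∈ drop d (oneLine π) → d ≤ toℕ (π ⟨$⟩ˡ y)
  ∈-drop-oneLine⁻ d y∈ with ∈-drop-tabulate⁻ (π ⟨$⟩ʳ_) d (subst (λ xs → _ ∈ drop d xs) oneLine≡tabulate y∈)
  ... | s , d≤s , refl = subst (λ t → d ≤ toℕ t) (sym (inverseˡ π)) d≤s

  ∈-take-oneLine⁻ : ∀ d {y} → y ∈ take d (oneLine π) → toℕ (π ⟨$⟩ˡ y) < d
  ∈-take-oneLine⁻ d y∈ with ∈-take-tabulate⁻ (π ⟨$⟩ʳ_) d (subst (λ xs → _ ∈ take d xs) oneLine≡tabulate y∈)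
  ... | s , s<d , refl = subst (λ t → toℕ t < d) (sym (inverseˡ π)) s<d

module _ {n : ℕ} (π : Permutation′ (suc n)) where

  private
    P : ℕ
    P = toℕ (posK π)

  lookup-vsum-drop-oneLine : ∀ d c → lookup (vsum unitK (drop d (oneLine π))) c ≡ ind (d ≤ᵇ toℕ (π ⟨$⟩ˡ inject₁ c))
  lookup-vsum-drop-oneLine d c with d ℕ.≤? toℕ (π ⟨$⟩ˡ inject₁ c)
  ... | yes d≤ = trans (lookup-vsum-unitK-∈ (Unique.drop⁺ d (unique-oneLine π)) c∈) (sym (ind-T (ℕ.≤⇒≤ᵇ d≤)))
    where
    c∈ : inject₁ c ∈ drop d (oneLine π)
    c∈ = subst (_∈ drop d (oneLine π)) (inverseʳ π) (∈-drop-oneLine⁺ π _ d≤)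
  ... | no  d≰ = trans (lookup-vsum-unitK-∉ _ (d≰ ∘ ∈-drop-oneLine⁻ π d)) (sym (ind-¬T (d≰ ∘ ℕ.≤ᵇ⇒≤ d _)))

  fromℕ∉drop : ∀ {d} → toℕ (posK π) < d → All (fromℕ n ≢_) (drop d (oneLine π))
  fromℕ∉drop {d} P<d = All.tabulate λ y∈ n≡y →
    ℕ.<⇒≱ P<d (∈-drop-oneLine⁻ π d (subst (_∈ drop d (oneLine π)) (sym n≡y) y∈))

  fromℕ∉before : All (fromℕ n ≢_) (before π)
  fromℕ∉before = All.tabulate λ y∈ n≡y →
    ℕ.<-irrefl refl (∈-take-oneLine⁻ π P (subst (_∈ before π) (sym n≡y) y∈))

  length-after : length (after π) ≡ n ∸ toℕ (posK π)
  length-after = trans (List.length-drop (suc P) (oneLine π)) (cong (_∸ suc P) (length-oneLine π))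

  basePoint : Pt n → Pt n
  basePoint w = w ⊖ vsum unitK (after π)

  indexedFacet≡walk : ∀ w → indexedFacet w π ≡ walk unitK (basePoint w) (after π ++ before π)
  indexedFacet≡walk w = cong₂ (walk unitK) (foldr-⊖≡⊖vsum unitK w (after π)) reverse-π′
    where
    reverse-π′ : List.reverse (π′ π) ≡ after π ++ before π
    reverse-π′ = trans (List.reverse-++ (List.reverse (before π)) (List.reverse (after π)))
                       (cong₂ _++_ (List.reverse-involutive (after π)) (List.reverse-involutive (before π)))

  basePoint-⊕ : ∀ w {t} → t ≤ length (after π) →
                basePoint w ⊕ vsum unitK (take t (after π ++ before π)) ≡
                w ⊖ vsum unitK (drop (suc (toℕ (posK π)) ℕ.+ t) (oneLine π))
  basePoint-⊕ w {t} t≤ = trans (⊖vsum-⊕vsum-take unitK w (after π) (before π) t≤)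
                               (cong (λ xs → w ⊖ vsum unitK xs) (List.drop-drop (suc P) t (oneLine π)))

module _ {n : ℕ} (v : Pt n) where

  lookup-vtx : ∀ x c → lookup (vtx v x) c ≡ lookup v c + ind (suc n ∸ x ≤ᵇ toℕ c)
  lookup-vtx x c = Vec.lookup∘tabulate _ c

  coordSum-vtx : ∀ {x} → x ≤ n → coordSum (vtx v (suc x)) ≡ coordSum v + + x
  coordSum-vtx {x} x≤n = begin
    coordSum (vtx v (suc x))                                            ≡⟨ coordSum-tabulate-+ v _ ⟩
    coordSum v + coordSum (tabulate {n = n} λ c → ind (n ∸ x ≤ᵇ toℕ c)) ≡⟨ cong (_+_ (coordSum v)) (coordSum-tabulate-≤ᵇ n (n ∸ x)) ⟩
    coordSum v + + (n ∸ (n ∸ x))                                        ≡⟨ cong (λ y → coordSum v + + y) (ℕ.m∸[m∸n]≡n x≤n) ⟩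
    coordSum v + + x                                                    ∎
    where open ≡-Reasoning

-- Membership of v⁽ⁱ⁾ in the facet of star(v⁽ʲ⁾) indexed by π

-- Here i and j are the paper's i − 1 and j − 1.
module _ {n : ℕ} (v : Pt n) {i j : ℕ} (i<j : i < j) (j≤n : j ≤ n) (π : Permutation′ (suc n)) where

  private
    w : Pt n
    w = vtx v (suc j)

    P δ d : ℕ
    P = toℕ (posK π)
    δ = j ∸ i
    d = suc n ∸ δ

    L : List (Fin (suc n))
    L = after π ++ before π

    candidate : Pt n
    candidate = w ⊖ vsum unitK (drop d (oneLine π))

    i≤j : i ≤ j
    i≤j = ℕ.<⇒≤ i<j

    lookup-candidate : ∀ c → lookup candidate c ≡
                             (lookup v c + ind (n ∸ j ≤ᵇ toℕ c)) - ind (d ≤ᵇ toℕ (π ⟨$⟩ˡ inject₁ c))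
    lookup-candidate c = trans (lookup-⊖ w _ c) (cong₂ _-_ (lookup-vtx v (suc j) c) (lookup-vsum-drop-oneLine π d c))

    vertex-sums : ∀ {t} → t ≤ length L → vtx v (suc i) ≡ basePoint π w ⊕ vsum unitK (take t L) →
                  i ℕ.+ (n ∸ P) ≡ j ℕ.+ t
    vertex-sums {t} t≤L v⁽ⁱ⁾≡ = x+a≡x+b-c+e⇒a+c≡b+e (coordSum v) i j (n ∸ P) t (begin
      coordSum v + + i
        ≡⟨ coordSum-vtx v (ℕ.≤-trans i≤j j≤n) ⟨
      coordSum (vtx v (suc i))
        ≡⟨ cong coordSum v⁽ⁱ⁾≡ ⟩
      coordSum (basePoint π w ⊕ vsum unitK (take t L))
        ≡⟨ coordSum-⊕ (basePoint π w) _ ⟩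
      coordSum (w ⊖ vsum unitK (after π)) + coordSum (vsum unitK (take t L))
        ≡⟨ cong₂ _+_ (coordSum-⊖ w _) (coordSum-vsum-unitK (All.take⁺ t (All.++⁺ after≢n (fromℕ∉before π)))) ⟩
      (coordSum w - coordSum (vsum unitK (after π))) + + length (take t L)
        ≡⟨ cong₂ (λ a b → (a - b) + + length (take t L)) (coordSum-vtx v j≤n) (coordSum-vsum-unitK after≢n) ⟩
      ((coordSum v + + j) - + length (after π)) + + length (take t L)
        ≡⟨ cong₂ (λ a b → ((coordSum v + + j) - + a) + + b) (length-after π) (trans (List.length-take t L) (ℕ.m≤n⇒m⊓n≡m t≤L)) ⟩
      ((coordSum v + + j) - + (n ∸ P)) + + t ∎)
      where
      open ≡-Reasoning
      after≢n : All (fromℕ n ≢_) (after π)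
      after≢n = fromℕ∉drop π (ℕ.n<1+n P)

    start-of-last-entries : ∀ {t} → i ℕ.+ (n ∸ P) ≡ j ℕ.+ t → suc P ℕ.+ t ≡ d
    start-of-last-entries {t} sums = sym (begin
      suc n ∸ δ                   ≡⟨ cong (λ m → suc m ∸ δ) (ℕ.m+[n∸m]≡n (ℕ.≤-pred (Fin.toℕ<n (posK π)))) ⟨
      suc (P ℕ.+ (n ∸ P)) ∸ δ     ≡⟨ cong (λ m → suc (P ℕ.+ m) ∸ δ) n∸P≡δ+t ⟩
      suc (P ℕ.+ (δ ℕ.+ t)) ∸ δ   ≡⟨ cong (_∸ δ) (rearrange P δ t) ⟩
      δ ℕ.+ (suc P ℕ.+ t) ∸ δ     ≡⟨ ℕ.m+n∸m≡n δ (suc P ℕ.+ t) ⟩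
      suc P ℕ.+ t                 ∎)
      where
      open ≡-Reasoning
      rearrange : ∀ P δ t → suc (P ℕ.+ (δ ℕ.+ t)) ≡ δ ℕ.+ (suc P ℕ.+ t)
      rearrange = ℕ-solve-∀
      n∸P≡δ+t : n ∸ P ≡ δ ℕ.+ t
      n∸P≡δ+t = ℕ.+-cancelˡ-≡ i (n ∸ P) (δ ℕ.+ t) (begin
        i ℕ.+ (n ∸ P)     ≡⟨ sums ⟩
        j ℕ.+ t           ≡⟨ cong (ℕ._+ t) (ℕ.m+[n∸m]≡n i≤j) ⟨
        i ℕ.+ δ ℕ.+ t     ≡⟨ ℕ.+-assoc i δ t ⟩
        i ℕ.+ (δ ℕ.+ t)   ∎)

    ∈indexedFacet⇒candidate : vtx v (suc i) ∈ indexedFacet w π → P < d × vtx v (suc i) ≡ candidate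
    ∈indexedFacet⇒candidate v⁽ⁱ⁾∈ with ∈-walk⁻ unitK L (subst (vtx v (suc i) ∈_) (indexedFacet≡walk π w) v⁽ⁱ⁾∈)
    ... | t , t≤L , v⁽ⁱ⁾≡ =
      subst (P <_) position (ℕ.m≤m+n (suc P) t) ,
      trans v⁽ⁱ⁾≡ (trans (basePoint-⊕ π w t≤after) (cong (λ e → w ⊖ vsum unitK (drop e (oneLine π))) position))
      where
      sums : i ℕ.+ (n ∸ P) ≡ j ℕ.+ t
      sums = vertex-sums t≤L v⁽ⁱ⁾≡
      position : suc P ℕ.+ t ≡ d
      position = start-of-last-entries sums
      t≤after : t ≤ length (after π)
      t≤after = subst (t ≤_) (sym (length-after π))
        (ℕ.+-cancelˡ-≤ i t (n ∸ P) (subst (i ℕ.+ t ≤_) (sym sums) (ℕ.+-monoˡ-≤ t i≤j)))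

    candidate∈indexedFacet : P < d → vtx v (suc i) ≡ candidate → vtx v (suc i) ∈ indexedFacet w π
    candidate∈indexedFacet P<d v⁽ⁱ⁾≡ = subst (vtx v (suc i) ∈_) (sym (indexedFacet≡walk π w))
      (subst (_∈ walk unitK (basePoint π w) L) (sym v⁽ⁱ⁾≡vertex) (∈-walk⁺ unitK (basePoint π w) L t≤L))
      where
      t : ℕ
      t = d ∸ suc P
      t≤after : t ≤ length (after π)
      t≤after = subst (t ≤_) (sym (length-after π)) (ℕ.∸-monoˡ-≤ (suc P) (ℕ.m∸n≤m (suc n) δ))
      t≤L : t ≤ length L
      t≤L = ℕ.≤-trans t≤after (subst (length (after π) ≤_) (sym (List.length-++ (after π)))
                                      (ℕ.m≤m+n (length (after π)) (length (before π))))
      v⁽ⁱ⁾≡vertex : vtx v (suc i) ≡ basePoint π w ⊕ vsum unitK (take t L)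
      v⁽ⁱ⁾≡vertex = trans v⁽ⁱ⁾≡ (sym (trans (basePoint-⊕ π w t≤after)
        (cong (λ e → w ⊖ vsum unitK (drop e (oneLine π))) (ℕ.m+[n∸m]≡n P<d))))

    candidate⇒LastEntriesIn : P < d → vtx v (suc i) ≡ candidate → LastEntriesIn π (suc i) (suc j)
    candidate⇒LastEntriesIn P<d v⁽ⁱ⁾≡ s d≤s with fromℕ≢⇒inject₁ (π ⟨$⟩ʳ s) n≢πs
      where
      n≢πs : fromℕ n ≢ π ⟨$⟩ʳ s
      n≢πs n≡πs = ℕ.<⇒≱ (ℕ.<-≤-trans P<d d≤s)
                         (ℕ.≤-reflexive (cong toℕ (sym (trans (cong (π ⟨$⟩ˡ_) n≡πs) (inverseˡ π)))))
    ... | c , c≡πs = subst (n ∸ j ≤_) toℕc≡ (ℕ.≤ᵇ⇒≤ _ _ (proj₂ bits)) ,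
                     subst (_< n ∸ i) toℕc≡ (ℕ.≰⇒> (proj₁ bits ∘ ℕ.≤⇒≤ᵇ))
      where
      open ≡-Reasoning
      toℕc≡ : toℕ c ≡ toℕ (π ⟨$⟩ʳ s)
      toℕc≡ = trans (sym (Fin.toℕ-inject₁ c)) (cong toℕ c≡πs)
      d≤pos : d ≤ toℕ (π ⟨$⟩ˡ inject₁ c)
      d≤pos = subst (λ s → d ≤ toℕ s) (sym (trans (cong (π ⟨$⟩ˡ_) c≡πs) (inverseˡ π))) d≤s
      coordinate : lookup v c + ind (n ∸ i ≤ᵇ toℕ c) ≡ (lookup v c + ind (n ∸ j ≤ᵇ toℕ c)) - + 1
      coordinate = begin
        lookup v c + ind (n ∸ i ≤ᵇ toℕ c)
          ≡⟨ lookup-vtx v (suc i) c ⟨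
        lookup (vtx v (suc i)) c
          ≡⟨ cong (λ x → lookup x c) v⁽ⁱ⁾≡ ⟩
        lookup candidate c
          ≡⟨ lookup-candidate c ⟩
        (lookup v c + ind (n ∸ j ≤ᵇ toℕ c)) - ind (d ≤ᵇ toℕ (π ⟨$⟩ˡ inject₁ c))
          ≡⟨ cong (_-_ (lookup v c + ind (n ∸ j ≤ᵇ toℕ c))) (ind-T (ℕ.≤⇒≤ᵇ d≤pos)) ⟩
        (lookup v c + ind (n ∸ j ≤ᵇ toℕ c)) - + 1 ∎
      bits : ¬ T (n ∸ i ≤ᵇ toℕ c) × T (n ∸ j ≤ᵇ toℕ c)
      bits = x+ind≡x+ind-1⇒ (lookup v c) _ _ coordinate

    LastEntriesIn⇒P<d : LastEntriesIn π (suc i) (suc j) → P < d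
    LastEntriesIn⇒P<d last = ℕ.≰⇒> λ d≤P → ℕ.<⇒≱ (proj₂ (last (posK π) d≤P))
      (ℕ.≤-trans (ℕ.m∸n≤m n i) (ℕ.≤-reflexive (sym (trans (cong toℕ (inverseʳ π)) (Fin.toℕ-fromℕ n)))))

    LastEntriesIn⇒candidate : LastEntriesIn π (suc i) (suc j) → vtx v (suc i) ≡ candidate
    LastEntriesIn⇒candidate last = ≤∧coordSum≡⇒≡ pointwise sums
      where
      open ≡-Reasoning
      pointwise : ∀ c → lookup (vtx v (suc i)) c ℤ.≤ lookup candidate c
      pointwise c = subst₂ ℤ._≤_ (sym (lookup-vtx v (suc i) c)) (sym (lookup-candidate c))
                      (x+ind≤x+ind-ind (lookup v c) _ _ _ last-entry threshold-mono)
        where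
        last-entry : T (d ≤ᵇ toℕ (π ⟨$⟩ˡ inject₁ c)) → ¬ T (n ∸ i ≤ᵇ toℕ c) × T (n ∸ j ≤ᵇ toℕ c)
        last-entry d≤pos with last (π ⟨$⟩ˡ inject₁ c) (ℕ.≤ᵇ⇒≤ d _ d≤pos)
        ... | lo , hi = (λ p → ℕ.<⇒≱ (subst (_< n ∸ i) value hi) (ℕ.≤ᵇ⇒≤ _ _ p)) ,
                        ℕ.≤⇒≤ᵇ (subst (n ∸ j ≤_) value lo)
          where
          value : toℕ (π ⟨$⟩ʳ (π ⟨$⟩ˡ inject₁ c)) ≡ toℕ c
          value = trans (cong toℕ (inverseʳ π)) (Fin.toℕ-inject₁ c)
        threshold-mono : T (n ∸ i ≤ᵇ toℕ c) → T (n ∸ j ≤ᵇ toℕ c)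
        threshold-mono = ℕ.≤⇒≤ᵇ ∘ ℕ.≤-trans (ℕ.∸-monoʳ-≤ n i≤j) ∘ ℕ.≤ᵇ⇒≤ _ _
      length-last-entries : length (drop d (oneLine π)) ≡ δ
      length-last-entries = trans (List.length-drop d (oneLine π)) (trans (cong (_∸ d) (length-oneLine π))
        (ℕ.m∸[m∸n]≡n (ℕ.≤-trans (ℕ.m∸n≤m j i) (ℕ.≤-trans j≤n (ℕ.n≤1+n n)))))
      sums : coordSum (vtx v (suc i)) ≡ coordSum candidate
      sums = begin
        coordSum (vtx v (suc i))          ≡⟨ coordSum-vtx v (ℕ.≤-trans i≤j j≤n) ⟩
        coordSum v + + i                  ≡⟨ x+a≡x+[c+a]-c (coordSum v) i δ ⟩
        (coordSum v + + (δ ℕ.+ i)) - + δ  ≡⟨ cong (λ m → (coordSum v + + m) - + δ) (ℕ.m∸n+n≡m i≤j) ⟩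
        (coordSum v + + j) - + δ          ≡⟨ cong₂ _-_ (coordSum-vtx v j≤n) (trans (coordSum-vsum-unitK
                                               (fromℕ∉drop π (LastEntriesIn⇒P<d last))) (cong +_ length-last-entries)) ⟨
        coordSum w - coordSum (vsum unitK (drop d (oneLine π))) ≡⟨ coordSum-⊖ w _ ⟨
        coordSum candidate                ∎

  ∈indexedFacet⇒LastEntriesIn : vtx v (suc i) ∈ indexedFacet (vtx v (suc j)) π → LastEntriesIn π (suc i) (suc j)
  ∈indexedFacet⇒LastEntriesIn = uncurry candidate⇒LastEntriesIn ∘ ∈indexedFacet⇒candidate

  LastEntriesIn⇒∈indexedFacet : LastEntriesIn π (suc i) (suc j) → vtx v (suc i) ∈ indexedFacet (vtx v (suc j)) π
  LastEntriesIn⇒∈indexedFacet last = candidate∈indexedFacet (LastEntriesIn⇒P<d last) (LastEntriesIn⇒candidate last)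

-- Indexed facets are facets of T_{k,q}

module Reflection (n p : ℕ) (p≤n : p ≤ n) where

  reflectℕ : ℕ → ℕ
  reflectℕ x = if does (x ℕ.<? p) then p ∸ suc x else n ℕ.+ p ∸ x

  reflectℕ-< : ∀ {x} → x < p → reflectℕ x ≡ p ∸ suc x
  reflectℕ-< {x} x<p = cong (λ b → if b then p ∸ suc x else n ℕ.+ p ∸ x) (dec-true (x ℕ.<? p) x<p)

  reflectℕ-≥ : ∀ {x} → p ≤ x → reflectℕ x ≡ n ℕ.+ p ∸ x
  reflectℕ-≥ {x} p≤x = cong (λ b → if b then p ∸ suc x else n ℕ.+ p ∸ x) (dec-false (x ℕ.<? p) (ℕ.≤⇒≯ p≤x))

  <p⇒reflectℕ<p : ∀ {x} → x < p → reflectℕ x < p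
  <p⇒reflectℕ<p {x} x<p@(s≤s _) = subst (_< p) (sym (reflectℕ-< x<p)) (s≤s (ℕ.m∸n≤m _ x))

  ≥p⇒reflectℕ≥p : ∀ {x} → x ≤ n → p ≤ x → p ≤ reflectℕ x
  ≥p⇒reflectℕ≥p {x} x≤n p≤x = subst (p ≤_) (sym (reflectℕ-≥ p≤x))
    (subst (_≤ n ℕ.+ p ∸ x) (ℕ.m+n∸m≡n n p) (ℕ.∸-monoʳ-≤ (n ℕ.+ p) x≤n))

  reflectℕ≤n : ∀ {x} → x ≤ n → reflectℕ x ≤ n
  reflectℕ≤n {x} x≤n with x ℕ.<? p
  ... | yes x<p = subst (_≤ n) (sym (reflectℕ-< x<p)) (ℕ.≤-trans (ℕ.m∸n≤m p (suc x)) p≤n)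
  ... | no  x≮p = subst (_≤ n) (sym (reflectℕ-≥ (ℕ.≮⇒≥ x≮p)))
                    (ℕ.≤-trans (ℕ.∸-monoˡ-≤ x (ℕ.+-monoʳ-≤ n (ℕ.≮⇒≥ x≮p))) (ℕ.≤-reflexive (ℕ.m+n∸n≡m n x)))

  reflectℕ-involutive : ∀ {x} → x ≤ n → reflectℕ (reflectℕ x) ≡ x
  reflectℕ-involutive {x} x≤n with x ℕ.<? p
  ... | yes x<p@(s≤s x≤p-1) = begin
    reflectℕ (reflectℕ x)      ≡⟨ reflectℕ-< (<p⇒reflectℕ<p x<p) ⟩
    p ∸ suc (reflectℕ x)       ≡⟨ cong (λ y → p ∸ suc y) (reflectℕ-< x<p) ⟩
    p ∸ suc (p ∸ suc x)        ≡⟨ ℕ.m∸[m∸n]≡n x≤p-1 ⟩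
    x                          ∎
    where open ≡-Reasoning
  ... | no  x≮p = begin
    reflectℕ (reflectℕ x)      ≡⟨ reflectℕ-≥ (≥p⇒reflectℕ≥p x≤n (ℕ.≮⇒≥ x≮p)) ⟩
    n ℕ.+ p ∸ reflectℕ x       ≡⟨ cong (n ℕ.+ p ∸_) (reflectℕ-≥ (ℕ.≮⇒≥ x≮p)) ⟩
    n ℕ.+ p ∸ (n ℕ.+ p ∸ x)    ≡⟨ ℕ.m∸[m∸n]≡n (ℕ.≤-trans x≤n (ℕ.m≤m+n n p)) ⟩
    x                          ∎
    where open ≡-Reasoning

  reflect : Fin (suc n) → Fin (suc n)
  reflect x = Fin.fromℕ< (s≤s (reflectℕ≤n (ℕ.≤-pred (Fin.toℕ<n x))))

  toℕ-reflect : ∀ x → toℕ (reflect x) ≡ reflectℕ (toℕ x)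
  toℕ-reflect x = Fin.toℕ-fromℕ< _

  reflect-involutive : ∀ x → reflect (reflect x) ≡ x
  reflect-involutive x = Fin.toℕ-injective (begin
    toℕ (reflect (reflect x))   ≡⟨ toℕ-reflect (reflect x) ⟩
    reflectℕ (toℕ (reflect x))  ≡⟨ cong reflectℕ (toℕ-reflect x) ⟩
    reflectℕ (reflectℕ (toℕ x)) ≡⟨ reflectℕ-involutive (ℕ.≤-pred (Fin.toℕ<n x)) ⟩
    toℕ x                       ∎)
    where open ≡-Reasoning

  reflection : Permutation′ (suc n)
  reflection = permutation reflect reflect reflect-involutive reflect-involutive

punchIn-fromℕ : ∀ {n} (x : Fin n) → Fin.punchIn (fromℕ n) x ≡ inject₁ x
punchIn-fromℕ zero    = refl
punchIn-fromℕ (suc x) = cong suc (punchIn-fromℕ x)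

Chain : ∀ {n} → (ℤ → ℤ → Set) → Pt n → Set
Chain R x = ∀ a b → toℕ b ≡ suc (toℕ a) → R (lookup x a) (lookup x b)

Chain-tail : ∀ {n} (R : ℤ → ℤ → Set) a (x : Pt n) → Chain R (a ∷ x) → Chain R x
Chain-tail R a x chain a′ b b≡a′+1 = chain (suc a′) (suc b) (cong suc b≡a′+1)

chain-head≤ : ∀ {m} (x : Pt (suc m)) → Chain ℤ._≤_ x → ∀ c → lookup x zero ℤ.≤ lookup x c
chain-head≤           x       _     zero    = ℤ.≤-refl
chain-head≤ {suc m}   (a ∷ x) chain (suc c) =
  ℤ.≤-trans (chain zero (suc zero) refl) (chain-head≤ x (Chain-tail ℤ._≤_ a x chain) c)

chain-≤last : ∀ {m} (x : Pt (suc m)) → Chain ℤ._≤_ x → ∀ c → lookup x c ℤ.≤ lookup x (fromℕ m)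
chain-≤last {zero}  (a ∷ []) _     zero    = ℤ.≤-refl
chain-≤last {suc m} (a ∷ x)  chain zero    =
  ℤ.≤-trans (chain zero (suc zero) refl) (chain-≤last x (Chain-tail ℤ._≤_ a x chain) zero)
chain-≤last {suc m} (a ∷ x)  chain (suc c) = chain-≤last x (Chain-tail ℤ._≤_ a x chain) c

Interior : ∀ {n} → ℕ → Pt n → Set
Interior q w = (∀ c → + 0 ℤ.< lookup w c × lookup w c ℤ.< + q) × Chain ℤ._<_ w

module _ {n : ℕ} (π : Permutation′ (suc n)) where

  private
    P : ℕ
    P = toℕ (posK π)

    P≤n : P ≤ n
    P≤n = ℕ.≤-pred (Fin.toℕ<n (posK π))

  open Reflection n P P≤n

  -- Reflecting the positions before and after k turns the one-line notation of π into
  -- π′ followed by k; dropping the last position leaves π′ as a permutation of [k − 1].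
  facetPermutation : Permutation′ n
  facetPermutation = remove (fromℕ n) (reflection ∘ₚ π)

  private
    σ : Permutation′ n
    σ = facetPermutation

    facetPermutation-spec : ∀ r → inject₁ (σ ⟨$⟩ʳ r) ≡ π ⟨$⟩ʳ reflect (inject₁ r)
    facetPermutation-spec r = begin
      inject₁ (σ ⟨$⟩ʳ r)                        ≡⟨ punchIn-fromℕ (σ ⟨$⟩ʳ r) ⟨
      Fin.punchIn (fromℕ n) (σ ⟨$⟩ʳ r)          ≡⟨ cong (λ y → Fin.punchIn y (σ ⟨$⟩ʳ r)) ρ-last ⟨
      Fin.punchIn (ρ ⟨$⟩ʳ fromℕ n) (σ ⟨$⟩ʳ r)   ≡⟨ punchIn-permute ρ (fromℕ n) r ⟨
      ρ ⟨$⟩ʳ Fin.punchIn (fromℕ n) r            ≡⟨ cong (ρ ⟨$⟩ʳ_) (punchIn-fromℕ r) ⟩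
      π ⟨$⟩ʳ reflect (inject₁ r)                ∎
      where
      open ≡-Reasoning
      ρ : Permutation′ (suc n)
      ρ = reflection ∘ₚ π
      reflect-last : reflect (fromℕ n) ≡ posK π
      reflect-last = Fin.toℕ-injective (trans (toℕ-reflect (fromℕ n))
        (trans (cong reflectℕ (Fin.toℕ-fromℕ n)) (trans (reflectℕ-≥ P≤n) (ℕ.m+n∸m≡n n P))))
      ρ-last : ρ ⟨$⟩ʳ fromℕ n ≡ fromℕ n
      ρ-last = trans (cong (π ⟨$⟩ʳ_) reflect-last) (inverseʳ π)

    e : ℕ
    e = n ∸ P

    n≡P+e : n ≡ P ℕ.+ e
    n≡P+e = sym (ℕ.m+[n∸m]≡n P≤n)

    reflectℕ-after : ∀ {x} → x < e → reflectℕ (P ℕ.+ x) ≡ suc P ℕ.+ (e ∸ suc x)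
    reflectℕ-after {x} x<e = begin
      reflectℕ (P ℕ.+ x)          ≡⟨ reflectℕ-≥ (ℕ.m≤m+n P x) ⟩
      n ℕ.+ P ∸ (P ℕ.+ x)         ≡⟨ cong (_∸ (P ℕ.+ x)) (ℕ.+-comm n P) ⟩
      P ℕ.+ n ∸ (P ℕ.+ x)         ≡⟨ ℕ.[m+n]∸[m+o]≡n∸o P n x ⟩
      n ∸ x                       ≡⟨ cong (_∸ x) n≡P+e ⟩
      P ℕ.+ e ∸ x                 ≡⟨ ℕ.+-∸-assoc P (ℕ.<⇒≤ x<e) ⟩
      P ℕ.+ (e ∸ x)               ≡⟨ cong (P ℕ.+_) (ℕ.+-∸-assoc 1 x<e) ⟩
      P ℕ.+ suc (e ∸ suc x)       ≡⟨ ℕ.+-suc P _ ⟩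
      suc P ℕ.+ (e ∸ suc x)       ∎
      where open ≡-Reasoning

    map-reflect-allFin : map (reflect ∘ inject₁) (List.allFin n) ≡ reversedBlocks P (List.allFin (suc n))
    map-reflect-allFin = List.map-injective Fin.toℕ-injective (begin
      map toℕ (map (reflect ∘ inject₁) (List.allFin n))
        ≡⟨ List.map-∘ (List.allFin n) ⟨
      map (toℕ ∘ reflect ∘ inject₁) (List.allFin n)
        ≡⟨ List.map-cong (λ r → trans (toℕ-reflect (inject₁ r)) (cong reflectℕ (Fin.toℕ-inject₁ r))) (List.allFin n) ⟩
      map (reflectℕ ∘ toℕ) (List.allFin n)
        ≡⟨ trans (map-allFin reflectℕ n) (cong (List.applyUpTo reflectℕ) n≡P+e) ⟩
      List.applyUpTo reflectℕ (P ℕ.+ e)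
        ≡⟨ applyUpTo-++ reflectℕ P e ⟩
      List.applyUpTo reflectℕ P ++ List.applyUpTo (reflectℕ ∘ (P ℕ.+_)) e
        ≡⟨ cong₂ _++_ (applyUpTo≡applyDownFrom P reflectℕ-<) (applyUpTo≡applyDownFrom e reflectℕ-after) ⟩
      List.downFrom P ++ List.applyDownFrom (suc P ℕ.+_) e
        ≡⟨ reversedBlocks-upTo P e ⟨
      reversedBlocks P (List.upTo (suc (P ℕ.+ e)))
        ≡⟨ cong (λ m → reversedBlocks P (List.upTo (suc m))) n≡P+e ⟨
      reversedBlocks P (List.upTo (suc n))
        ≡⟨ cong (reversedBlocks P) (map-allFin id (suc n)) ⟨
      reversedBlocks P (map toℕ (List.allFin (suc n)))
        ≡⟨ map-reversedBlocks toℕ P (List.allFin (suc n)) ⟨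
      map toℕ (reversedBlocks P (List.allFin (suc n))) ∎)
      where open ≡-Reasoning

    toℕ-π⁻¹-inject₁ : ∀ c → toℕ (π ⟨$⟩ˡ inject₁ c) ≡ reflectℕ (toℕ (σ ⟨$⟩ˡ c))
    toℕ-π⁻¹-inject₁ c = begin
      toℕ (π ⟨$⟩ˡ inject₁ c)                                ≡⟨ cong (λ y → toℕ (π ⟨$⟩ˡ inject₁ y)) (inverseʳ σ) ⟨
      toℕ (π ⟨$⟩ˡ inject₁ (σ ⟨$⟩ʳ (σ ⟨$⟩ˡ c)))              ≡⟨ cong (toℕ ∘ (π ⟨$⟩ˡ_)) (facetPermutation-spec (σ ⟨$⟩ˡ c)) ⟩
      toℕ (π ⟨$⟩ˡ (π ⟨$⟩ʳ reflect (inject₁ (σ ⟨$⟩ˡ c))))   ≡⟨ cong toℕ (inverseˡ π) ⟩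
      toℕ (reflect (inject₁ (σ ⟨$⟩ˡ c)))                    ≡⟨ toℕ-reflect _ ⟩
      reflectℕ (toℕ (inject₁ (σ ⟨$⟩ˡ c)))                   ≡⟨ cong reflectℕ (Fin.toℕ-inject₁ _) ⟩
      reflectℕ (toℕ (σ ⟨$⟩ˡ c))                             ∎
      where open ≡-Reasoning

    facetPermutation-< : ∀ c → toℕ (π ⟨$⟩ˡ inject₁ c) < P → toℕ (σ ⟨$⟩ˡ c) < P
    facetPermutation-< c pos<P = ℕ.≰⇒> λ P≤r →
      ℕ.<⇒≱ pos<P (subst (P ≤_) (sym (toℕ-π⁻¹-inject₁ c)) (≥p⇒reflectℕ≥p (ℕ.<⇒≤ (Fin.toℕ<n (σ ⟨$⟩ˡ c))) P≤r))

    facetPermutation-≥ : ∀ c → P < toℕ (π ⟨$⟩ˡ inject₁ c) → P ≤ toℕ (σ ⟨$⟩ˡ c)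
    facetPermutation-≥ c P<pos = ℕ.≮⇒≥ λ r<P →
      ℕ.<⇒≱ P<pos (ℕ.<⇒≤ (subst (_< P) (sym (toℕ-π⁻¹-inject₁ c)) (<p⇒reflectℕ<p r<P)))

  map-inject₁-oneLine : map inject₁ (oneLine facetPermutation) ≡ π′ π
  map-inject₁-oneLine = begin
    map inject₁ (map (σ ⟨$⟩ʳ_) (List.allFin n))              ≡⟨ List.map-∘ (List.allFin n) ⟨
    map (inject₁ ∘ (σ ⟨$⟩ʳ_)) (List.allFin n)                ≡⟨ List.map-cong facetPermutation-spec (List.allFin n) ⟩
    map ((π ⟨$⟩ʳ_) ∘ reflect ∘ inject₁) (List.allFin n)      ≡⟨ List.map-∘ (List.allFin n) ⟩
    map (π ⟨$⟩ʳ_) (map (reflect ∘ inject₁) (List.allFin n))  ≡⟨ cong (map (π ⟨$⟩ʳ_)) map-reflect-allFin ⟩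
    map (π ⟨$⟩ʳ_) (reversedBlocks P (List.allFin (suc n)))   ≡⟨ map-reversedBlocks (π ⟨$⟩ʳ_) P (List.allFin (suc n)) ⟩
    π′ π                                                     ∎
    where open ≡-Reasoning

  indexedFacet≡simplex : ∀ w → indexedFacet w π ≡ simplex (basePoint π w) facetPermutation
  indexedFacet≡simplex w = begin
    indexedFacet w π
      ≡⟨ cong₂ (walk unitK) (foldr-⊖≡⊖vsum unitK w (after π)) (cong List.reverse (sym map-inject₁-oneLine)) ⟩
    walk unitK (basePoint π w) (List.reverse (map inject₁ (oneLine σ)))
      ≡⟨ cong (walk unitK (basePoint π w)) (List.reverse-map inject₁ (oneLine σ)) ⟨
    walk unitK (basePoint π w) (map inject₁ (List.reverse (oneLine σ)))
      ≡⟨ walk-map unitK inject₁ (basePoint π w) (List.reverse (oneLine σ)) ⟩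
    walk (unitK ∘ inject₁) (basePoint π w) (List.reverse (oneLine σ))
      ≡⟨ walk-cong unitK-inject₁ (basePoint π w) (List.reverse (oneLine σ)) ⟩
    simplex (basePoint π w) σ ∎
    where open ≡-Reasoning

  module _ {q : ℕ} {w : Pt n} (interior : Interior q w) where

    private
      pos : Fin n → Fin (suc n)
      pos c = π ⟨$⟩ˡ inject₁ c

      lookup-basePoint : ∀ c → lookup (basePoint π w) c ≡ lookup w c - ind (suc P ≤ᵇ toℕ (pos c))
      lookup-basePoint c = trans (lookup-⊖ w _ c) (cong (_-_ (lookup w c)) (lookup-vsum-drop-oneLine π (suc P) c))

      pos≢P : ∀ c → toℕ (pos c) ≢ P
      pos≢P c pos≡P = Fin.fromℕ≢inject₁ (begin
        fromℕ n                ≡⟨ inverseʳ π ⟨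
        π ⟨$⟩ʳ posK π           ≡⟨ cong (π ⟨$⟩ʳ_) (Fin.toℕ-injective pos≡P) ⟨
        π ⟨$⟩ʳ pos c            ≡⟨ inverseʳ π ⟩
        inject₁ c              ∎)
        where open ≡-Reasoning

    basePoint∈W : InW q (basePoint π w)
    basePoint∈W = bounds , monotone
      where
      bounds : ∀ c → + 0 ℤ.≤ lookup (basePoint π w) c × lookup (basePoint π w) c ℤ.≤ + q
      bounds c = subst (+ 0 ℤ.≤_) (sym (lookup-basePoint c)) (0<x⇒0≤x-ind _ (proj₁ (proj₁ interior c))) ,
                 subst (ℤ._≤ + q) (sym (lookup-basePoint c))
                   (ℤ.≤-trans (x-ind≤x _ _) (ℤ.<⇒≤ (proj₂ (proj₁ interior c))))
      monotone : Chain ℤ._≤_ (basePoint π w)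
      monotone a b b≡a+1 = subst₂ ℤ._≤_ (sym (lookup-basePoint a)) (sym (lookup-basePoint b))
                             (<⇒x-ind≤y-ind _ _ (proj₂ interior a b b≡a+1))

    consistent : Consistent (basePoint π w) facetPermutation
    consistent a b b≡a+1 wπa≡wπb =
      ℕ.<-≤-trans (facetPermutation-< a pos-a<P) (facetPermutation-≥ b (ℕ.≤ᵇ⇒≤ (suc P) (toℕ (pos b)) (proj₂ bits)))
      where
      bits : ¬ T (suc P ≤ᵇ toℕ (pos a)) × T (suc P ≤ᵇ toℕ (pos b))
      bits = <∧x-ind≡y-ind⇒ (suc P ≤ᵇ toℕ (pos a)) (suc P ≤ᵇ toℕ (pos b)) (proj₂ interior a b b≡a+1)
               (trans (sym (lookup-basePoint a)) (trans wπa≡wπb (lookup-basePoint b)))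
      pos-a<P : toℕ (pos a) < P
      pos-a<P = ℕ.≤∧≢⇒< (ℕ.≤-pred (ℕ.≰⇒> (proj₁ bits ∘ ℕ.≤⇒≤ᵇ))) (pos≢P a)

    indexedFacet-isFacet : IsFacetT q (indexedFacet w π)
    indexedFacet-isFacet = basePoint π w , facetPermutation , basePoint∈W , consistent ,
      λ x → subst (x ∈_) (indexedFacet≡simplex w) , subst (x ∈_) (sym (indexedFacet≡simplex w))

vtx-interior : ∀ {m q} (v : Pt (suc m)) → + 0 ℤ.< lookup v zero → Chain ℤ._<_ v →
               lookup v (fromℕ m) ℤ.< + q - + 1 → ∀ j → Interior q (vtx v j)
vtx-interior {m} {q} v 0<v₀ v↑ vₘ<q-1 j = bounds , increasing
  where
  v-mono : Chain ℤ._≤_ v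
  v-mono a b b≡a+1 = ℤ.<⇒≤ (v↑ a b b≡a+1)

  vₘ+1<q : lookup v (fromℕ m) + + 1 ℤ.< + q
  vₘ+1<q = subst (lookup v (fromℕ m) + + 1 ℤ.<_) (cancel (+ q)) (ℤ.+-monoˡ-< (+ 1) vₘ<q-1)
    where
    cancel : ∀ x → (x - + 1) + + 1 ≡ x
    cancel = solve-∀

  bounds : ∀ c → + 0 ℤ.< lookup (vtx v j) c × lookup (vtx v j) c ℤ.< + q
  bounds c = subst (+ 0 ℤ.<_) (sym (lookup-vtx v j c))
               (ℤ.<-≤-trans 0<v₀ (ℤ.≤-trans (chain-head≤ v v-mono c) (ℤ.≤-trans (ℤ.≤-reflexive (sym (ℤ.+-identityʳ _)))
                 (ℤ.+-monoʳ-≤ (lookup v c) (ind-mono {false} λ ()))))) ,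
             subst (ℤ._< + q) (sym (lookup-vtx v j c))
               (ℤ.≤-<-trans (ℤ.+-mono-≤ (chain-≤last v v-mono c) (ind-mono {q = true} λ _ → tt)) vₘ+1<q)

  increasing : Chain ℤ._<_ (vtx v j)
  increasing a b b≡a+1 = subst₂ ℤ._<_ (sym (lookup-vtx v j a)) (sym (lookup-vtx v j b))
    (ℤ.+-mono-<-≤ (v↑ a b b≡a+1) (ind-mono (ℕ.≤⇒≤ᵇ ∘ (λ t≤a → ℕ.≤-trans t≤a a≤b) ∘ ℕ.≤ᵇ⇒≤ (suc (suc m) ∸ j) (toℕ a))))
    where
    a≤b : toℕ a ≤ toℕ b
    a≤b = subst (toℕ a ≤_) (sym b≡a+1) (ℕ.n≤1+n (toℕ a))

mainTheorem11 : (m q : ℕ) → 1 ℕ.≤ q → (v : Vec ℤ (suc m)) → InW q v →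
    + 0 ℤ.< lookup v zero →
    (∀ (a b : Fin (suc m)) → toℕ b ≡ suc (toℕ a) → lookup v a ℤ.< lookup v b) →
    lookup v (fromℕ m) ℤ.< + q - + 1 →
    (i j : ℕ) → 1 ℕ.≤ i → i ℕ.< j → j ℕ.≤ suc (suc m) →
    (π : Permutation′ (suc (suc m))) →
    IsStarFacet q (vtx v i) (indexedFacet (vtx v j) π) ⇔ LastEntriesIn π i j
mainTheorem11 m q _ v _ 0<v₀ v↑ vₘ<q-1 (suc i) (suc j) (s≤s z≤n) (s≤s i<j) (s≤s j≤n) π =
  mk⇔ (∈indexedFacet⇒LastEntriesIn v i<j j≤n π ∘ proj₂)
      (λ last → indexedFacet-isFacet π (vtx-interior v 0<v₀ v↑ vₘ<q-1 (suc j)) ,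
                LastEntriesIn⇒∈indexedFacet v i<j j≤n π last)
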